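{- Let $(\mathbf{C},\mathcal{M})$ satisfy the standing assumptions of the context. Let $P,Q$ be objects, $in_P:P\to P+Q$ the coproduct injection, $a:P\to A$ an $\mathcal{M}$-morphism and $\mathsf{c}_A$ a condition over $A$. Then $\mathsf{Shift}(in_P,\exists(a,\mathsf{c}_A))$ may be computed by restricting, in the defining construction of $\mathsf{Shift}$, to spans of the form $$P+Q\xleftarrow{[id_P,w_1]}P+W\xrightarrow{[a,w_2]}A,\qquad x=in_P:P\to P+W,$$ with $W$ an object and $w_1:W\to Q$, $w_2:W\to A$ $\mathcal{M}$-morphisms (such that $[id_P,w_1]$ and $[a,w_2]$ lie in $\mathcal{M}$); that is, $\mathsf{Shift}(in_P,\exists(a,\mathsf{c}_A))\equiv\bigvee_{(r,s)}\exists(r,\mathsf{Shift}(s,\mathsf{c}_A))$, where $(r:P+Q\to E,s:A\to E)$ ranges over isomorphism classes of pushouts of such spans.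
   Context: Standing assumptions: $(\mathbf{C},\mathcal{M})$ is $\mathcal{M}$-adhesive with $\mathcal{M}$ a class of monomorphisms (contains isos; closed under composition and decomposition; pushouts/pullbacks along $\mathcal{M}$-morphisms exist and $\mathcal{M}$ is stable under them; pushouts along $\mathcal{M}$-morphisms are $\mathcal{M}$-van Kampen squares); $\mathbf{C}$ has epi-$\mathcal{M}$-factorizations, is balanced, has a strict $\mathcal{M}$-initial object $\varnothing$ (unique monomorphism $\varnothing\to A$ for each $A$, lying in $\mathcal{M}$; every morphism into $\varnothing$ is an iso), and has $\mathcal{M}$-effective unions. In this setting binary coproducts $P+Q$ exist (as pushouts of $P\leftarrow\varnothing\to Q$) with coproduct injections in $\mathcal{M}$; $[f,g]$ denotes the copairing. Conditions over $P$: $\mathsf{true}$, $\exists(a,\mathsf{c}_Q)$ ($a:P\to Q$ in $\mathcal{M}$), $\neg$, $\bigwedge$; $\bigvee=\neg\bigwedge\neg$. An $\mathcal{M}$-morphism $p$ satisfies $\exists(a,\mathsf{c}_Q)$ iff $p=q\circ a$ for some $\mathcal{M}$-morphism $q\models\mathsf{c}_Q$. $\equiv$: satisfied by the same $\mathcal{M}$-morphisms. $\mathsf{Shift}(p,\cdot)$ for an $\mathcal{M}$-morphism $p:P\to Q$: $\mathsf{Shift}(p,\mathsf{true})=\mathsf{true}$, commutes with $\neg,\bigwedge$, and $\mathsf{Shift}(p,\exists(a:P\to A,\mathsf{c}_A))=\bigvee_{(r,s)\in\mathcal{E}}\exists(r,\mathsf{Shift}(s,\mathsf{c}_A))$, where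 $\mathcal{E}$ is the set of iso classes of pushouts $(r:Q\to E,s:A\to E)$ of spans $Q\xleftarrow{p''}X\xrightarrow{a''}A$ of $\mathcal{M}$-morphisms for which some $\mathcal{M}$-morphism $x:P\to X$ satisfies $p''x=p$, $a''x=a$. -}

module Defs where

open import Level using (Level; _⊔_; suc; Lift)
open import Data.Product using (Σ; _×_; _,_; proj₁; proj₂)
open import Data.Unit using (⊤)
open import Relation.Binary using (IsEquivalence)
open import Relation.Nullary using (¬_)

record Category (o ℓ e : Level) : Set (suc (o ⊔ ℓ ⊔ e)) where
  infixr 9 _∘_
  infix  4 _≈_ _⇒_
  field
    Obj       : Set o
    _⇒_       : Obj → Obj → Set ℓ
    _≈_       : ∀ {A B} → A ⇒ B → A ⇒ B → Set e
    id        : ∀ {A} → A ⇒ A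
    _∘_       : ∀ {A B C} → B ⇒ C → A ⇒ B → A ⇒ C
    ≈-equiv   : ∀ {A B} → IsEquivalence (_≈_ {A} {B})
    assoc     : ∀ {A B C D} {f : A ⇒ B} {g : B ⇒ C} {h : C ⇒ D} →
                (h ∘ g) ∘ f ≈ h ∘ (g ∘ f)
    identityˡ : ∀ {A B} {f : A ⇒ B} → id ∘ f ≈ f
    identityʳ : ∀ {A B} {f : A ⇒ B} → f ∘ id ≈ f
    ∘-resp-≈  : ∀ {A B C} {f h : B ⇒ C} {g i : A ⇒ B} →
                f ≈ h → g ≈ i → f ∘ g ≈ h ∘ i

  ≈-sym : ∀ {A B} {f g : A ⇒ B} → f ≈ g → g ≈ f
  ≈-sym = IsEquivalence.sym ≈-equiv

module Notions {o ℓ e : Level} (𝒞 : Category o ℓ e) where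
  open Category 𝒞

  Mono : ∀ {A B} → A ⇒ B → Set (o ⊔ ℓ ⊔ e)
  Mono {A} f = ∀ {X} (g h : X ⇒ A) → f ∘ g ≈ f ∘ h → g ≈ h

  Epi : ∀ {A B} → A ⇒ B → Set (o ⊔ ℓ ⊔ e)
  Epi {B = B} f = ∀ {X} (g h : B ⇒ X) → g ∘ f ≈ h ∘ f → g ≈ h

  Iso : ∀ {A B} → A ⇒ B → Set (ℓ ⊔ e)
  Iso {A} {B} f = Σ (B ⇒ A) λ g → (g ∘ f ≈ id) × (f ∘ g ≈ id)

  -- A square      top
  --           A ------> B
  --      left |         | right
  --           v         v
  --           C ------> D
  --             bottom
  record IsPushout {A B C D : Obj} (top : A ⇒ B) (left : A ⇒ C)
                   (right : B ⇒ D) (bottom : C ⇒ D) : Set (o ⊔ ℓ ⊔ e) where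
    field
      commute   : right ∘ top ≈ bottom ∘ left
      universal : ∀ {X} {h : B ⇒ X} {k : C ⇒ X} → h ∘ top ≈ k ∘ left → D ⇒ X
      factor₁   : ∀ {X} {h : B ⇒ X} {k : C ⇒ X} (eq : h ∘ top ≈ k ∘ left) →
                  universal eq ∘ right ≈ h
      factor₂   : ∀ {X} {h : B ⇒ X} {k : C ⇒ X} (eq : h ∘ top ≈ k ∘ left) →
                  universal eq ∘ bottom ≈ k
      unique    : ∀ {X} {h : B ⇒ X} {k : C ⇒ X} (eq : h ∘ top ≈ k ∘ left)
                  (u : D ⇒ X) → u ∘ right ≈ h → u ∘ bottom ≈ k → u ≈ universal eq

  record IsPullback {A B C D : Obj} (top : A ⇒ B) (left : A ⇒ C)
                    (right : B ⇒ D) (bottom : C ⇒ D) : Set (o ⊔ ℓ ⊔ e) where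
    field
      commute   : right ∘ top ≈ bottom ∘ left
      universal : ∀ {X} {h : X ⇒ B} {k : X ⇒ C} → right ∘ h ≈ bottom ∘ k → X ⇒ A
      factor₁   : ∀ {X} {h : X ⇒ B} {k : X ⇒ C} (eq : right ∘ h ≈ bottom ∘ k) →
                  top ∘ universal eq ≈ h
      factor₂   : ∀ {X} {h : X ⇒ B} {k : X ⇒ C} (eq : right ∘ h ≈ bottom ∘ k) →
                  left ∘ universal eq ≈ k
      unique    : ∀ {X} {h : X ⇒ B} {k : X ⇒ C} (eq : right ∘ h ≈ bottom ∘ k)
                  (u : X ⇒ A) → top ∘ u ≈ h → left ∘ u ≈ k → u ≈ universal eq

  record Pushout {A B C : Obj} (top : A ⇒ B) (left : A ⇒ C) : Set (o ⊔ ℓ ⊔ e) where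
    field
      {obj}     : Obj
      right     : B ⇒ obj
      bottom    : C ⇒ obj
      isPushout : IsPushout top left right bottom

  record Pullback {B C D : Obj} (right : B ⇒ D) (bottom : C ⇒ D) : Set (o ⊔ ℓ ⊔ e) where
    field
      {obj}      : Obj
      top        : obj ⇒ B
      left       : obj ⇒ C
      isPullback : IsPullback top left right bottom

  pushout-transpose : ∀ {A B C D} {top : A ⇒ B} {left : A ⇒ C}
                      {right : B ⇒ D} {bottom : C ⇒ D} →
                      IsPushout top left right bottom →
                      IsPushout left top bottom right
  pushout-transpose po = record
    { commute   = ≈-sym commute
    ; universal = λ eq → universal (≈-sym eq)
    ; factor₁   = λ eq → factor₂ (≈-sym eq)
    ; factor₂   = λ eq → factor₁ (≈-sym eq)
    ; unique    = λ eq u p q → unique (≈-sym eq) u q p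
    }
    where open IsPushout po

-- The standing assumptions: M-adhesive category with epi-M-factorizations,
-- balanced, with a strict M-initial object and M-effective unions.

record MAdhesive {o ℓ e : Level} (𝒞 : Category o ℓ e) (m : Level)
       : Set (o ⊔ ℓ ⊔ e ⊔ suc m) where
  open Category 𝒞
  open Notions 𝒞
  field
    M        : ∀ {A B} → A ⇒ B → Set m
    M-resp-≈ : ∀ {A B} {f g : A ⇒ B} → f ≈ g → M f → M g
    M-mono   : ∀ {A B} {f : A ⇒ B} → M f → Mono f
    M-iso    : ∀ {A B} {f : A ⇒ B} → Iso f → M f
    M-∘      : ∀ {A B C} {f : A ⇒ B} {g : B ⇒ C} → M f → M g → M (g ∘ f)
    M-decomp : ∀ {A B C} {f : A ⇒ B} {g : B ⇒ C} → M (g ∘ f) → M g → M f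

    pushout        : ∀ {A B C} (f : A ⇒ B) (g : A ⇒ C) → M f → Pushout f g
    pushout-stable : ∀ {A B C D} {top : A ⇒ B} {left : A ⇒ C}
                     {right : B ⇒ D} {bottom : C ⇒ D} →
                     M top → IsPushout top left right bottom → M bottom
    pullback        : ∀ {B C D} (f : B ⇒ D) (g : C ⇒ D) → M f → Pullback f g
    pullback-stable : ∀ {A B C D} {top : A ⇒ B} {left : A ⇒ C}
                      {right : B ⇒ D} {bottom : C ⇒ D} →
                      M right → IsPullback top left right bottom → M left

    -- pushouts along M-morphisms are M-van Kampen squares
    van-Kampen :
      ∀ {A B C D} {f : A ⇒ B} {g : A ⇒ C} {n : B ⇒ D} {k : C ⇒ D} →
      M f → IsPushout f g n k →
      ∀ {A' B' C' D'} {f' : A' ⇒ B'} {g' : A' ⇒ C'} {n' : B' ⇒ D'} {k' : C' ⇒ D'}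
        {a : A' ⇒ A} {b : B' ⇒ B} {c : C' ⇒ C} {d : D' ⇒ D} →
      n' ∘ f' ≈ k' ∘ g' →
      d ∘ n' ≈ n ∘ b → d ∘ k' ≈ k ∘ c →
      IsPullback f' a b f → IsPullback g' a c g →
      M b → M c → M d →
      (IsPushout f' g' n' k' → IsPullback n' b d n × IsPullback k' c d k) ×
      (IsPullback n' b d n × IsPullback k' c d k → IsPushout f' g' n' k')

    epi-M-factor : ∀ {A B} (f : A ⇒ B) →
                   Σ Obj λ C → Σ (A ⇒ C) λ ε → Σ (C ⇒ B) λ μ →
                   Epi ε × M μ × (μ ∘ ε ≈ f)

    balanced : ∀ {A B} {f : A ⇒ B} → Mono f → Epi f → Iso f

    ∅          : Obj
    ¡          : ∀ {A} → ∅ ⇒ A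
    ¡-mono     : ∀ {A} → Mono (¡ {A})
    ¡-M        : ∀ {A} → M (¡ {A})
    ¡-unique   : ∀ {A} (f : ∅ ⇒ A) → Mono f → f ≈ ¡
    ∅-strict   : ∀ {A} (f : A ⇒ ∅) → Iso f

    effective-unions :
      ∀ {A B₁ B₂ E D} {a₁ : A ⇒ B₁} {a₂ : A ⇒ B₂} {b₁ : B₁ ⇒ E} {b₂ : B₂ ⇒ E}
        {c₁ : B₁ ⇒ D} {c₂ : B₂ ⇒ D} →
      M a₁ → M a₂ → M b₁ → M b₂ →
      IsPullback a₁ a₂ b₁ b₂ → IsPushout a₁ a₂ c₁ c₂ →
      (u : D ⇒ E) → u ∘ c₁ ≈ b₁ → u ∘ c₂ ≈ b₂ → M u

module Conditions {o ℓ e m : Level} (𝒞 : Category o ℓ e) (MA : MAdhesive 𝒞 m) where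
  open Category 𝒞
  open Notions 𝒞
  open MAdhesive MA

  κ : Level
  κ = o ⊔ ℓ ⊔ e ⊔ m

  coprod : (P Q : Obj) → Pushout (¡ {P}) (¡ {Q})
  coprod P Q = pushout ¡ ¡ ¡-M

  _+_ : Obj → Obj → Obj
  P + Q = Pushout.obj (coprod P Q)

  inP : (P Q : Obj) → P ⇒ P + Q
  inP P Q = Pushout.right (coprod P Q)

  inQ : (P Q : Obj) → Q ⇒ P + Q
  inQ P Q = Pushout.bottom (coprod P Q)

  inP-M : (P Q : Obj) → M (inP P Q)
  inP-M P Q = pushout-stable ¡-M (pushout-transpose (Pushout.isPushout (coprod P Q)))

  inQ-M : (P Q : Obj) → M (inQ P Q)
  inQ-M P Q = pushout-stable ¡-M (Pushout.isPushout (coprod P Q))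

  data Cond : Obj → Set (suc κ) where
    true : ∀ {P} → Cond P
    ∃c   : ∀ {P A} (a : P ⇒ A) → M a → Cond A → Cond P
    ¬c   : ∀ {P} → Cond P → Cond P
    ⋀    : ∀ {P} (I : Set κ) → (I → Cond P) → Cond P

  ⋁ : ∀ {P} (I : Set κ) → (I → Cond P) → Cond P
  ⋁ I f = ¬c (⋀ I (λ i → ¬c (f i)))

  infix 4 _⊨_
  _⊨_ : ∀ {P G} → P ⇒ G → Cond P → Set κ
  p ⊨ true       = Lift κ ⊤
  _⊨_ {G = G} p (∃c {A = A} a _ c) = Σ (A ⇒ G) λ q → M q × (q ∘ a ≈ p) × (q ⊨ c)
  p ⊨ ¬c c       = ¬ (p ⊨ c)
  p ⊨ ⋀ I f      = (i : I) → p ⊨ f i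

  infix 4 _≡c_
  _≡c_ : ∀ {P} → Cond P → Cond P → Set κ
  _≡c_ {P} c₁ c₂ = ∀ {G} (p : P ⇒ G) → M p → (p ⊨ c₁ → p ⊨ c₂) × (p ⊨ c₂ → p ⊨ c₁)

  record ShiftSpan {P Q A : Obj} (p : P ⇒ Q) (a : P ⇒ A) : Set κ where
    field
      X    : Obj
      p''  : X ⇒ Q
      a''  : X ⇒ A
      p''M : M p''
      a''M : M a''
      x    : P ⇒ X
      xM   : M x
      p''x : p'' ∘ x ≈ p
      a''x : a'' ∘ x ≈ a

  module SpanPushout {X Q A : Obj} (p'' : X ⇒ Q) (a'' : X ⇒ A)
                     (p''M : M p'') (a''M : M a'') where
    po : Pushout a'' p''
    po = pushout a'' p'' a''M

    r : Q ⇒ Pushout.obj po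
    r = Pushout.bottom po

    s : A ⇒ Pushout.obj po
    s = Pushout.right po

    rM : M r
    rM = pushout-stable a''M (Pushout.isPushout po)

    sM : M s
    sM = pushout-stable p''M (pushout-transpose (Pushout.isPushout po))

  Shift : ∀ {P Q} (p : P ⇒ Q) → M p → Cond P → Cond Q
  Shift p pM true         = true
  Shift p pM (∃c a aM c)  =
    ⋁ (ShiftSpan p a) λ σ →
      let open ShiftSpan σ
          open SpanPushout p'' a'' p''M a''M
      in ∃c r rM (Shift s sM c)
  Shift p pM (¬c c)       = ¬c (Shift p pM c)
  Shift p pM (⋀ I f)      = ⋀ I (λ i → Shift p pM (f i))

  -- the restricted spans of Lemma 3.6:
  --   P + Q <-[id_P , w₁]- P + W -[a , w₂]-> A ,  x = inP : P -> P + W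
  -- where u₁ = [id_P , w₁] (= id_P + w₁) and u₂ = [a , w₂] are given by
  -- their defining equations on the coproduct injections.
  record CoprodSpan (P Q : Obj) {A : Obj} (a : P ⇒ A) : Set κ where
    field
      W     : Obj
      w₁    : W ⇒ Q
      w₂    : W ⇒ A
      w₁M   : M w₁
      w₂M   : M w₂
      u₁    : P + W ⇒ P + Q
      u₂    : P + W ⇒ A
      u₁-inP : u₁ ∘ inP P W ≈ inP P Q
      u₁-inW : u₁ ∘ inQ P W ≈ inQ P Q ∘ w₁
      u₂-inP : u₂ ∘ inP P W ≈ a
      u₂-inW : u₂ ∘ inQ P W ≈ w₂
      u₁M   : M u₁
      u₂M   : M u₂

  RestrictedShift : (P Q : Obj) {A : Obj} (a : P ⇒ A) → M a → Cond A → Cond (P + Q)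
  RestrictedShift P Q a aM c =
    ⋁ (CoprodSpan P Q a) λ σ →
      let open CoprodSpan σ
          open SpanPushout u₁ u₂ u₁M u₂M
      in ∃c r rM (Shift s sM c)

-- Every span Q ← X → A of the defining construction of Shift(in_P, ∃(a, c)) is
-- isomorphic to one of the restricted shape. Pulling the M-morphism p'' : X → P + Q back along
-- in_Q gives W → X, and since the coproduct square ∅ → P, ∅ → Q is a pushout
-- along M, the van Kampen property splits X as the coproduct P + W, with
-- injections x and W → X. Precomposing the span with this isomorphism
-- P + W ≅ X yields a restricted span with an isomorphic pushout, and Shift is
-- invariant under such isomorphisms.
module Submission where

open import Level using (Level)
open import Data.Product using (Σ; _×_; _,_; proj₁; proj₂)
open import Relation.Binary using (IsEquivalence; Setoid)
open import Relation.Nullary using (¬_)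
import Relation.Binary.Reasoning.Setoid as SetoidReasoning
open import Defs

module ShiftProperties {o ℓ e m : Level} (𝒞 : Category o ℓ e) (MA : MAdhesive 𝒞 m) where
  open Category 𝒞
  open Notions 𝒞
  open MAdhesive MA
  open Conditions 𝒞 MA

  hom-setoid : Obj → Obj → Setoid ℓ e
  hom-setoid A B = record { Carrier = A ⇒ B ; _≈_ = _≈_ ; isEquivalence = ≈-equiv }

  module HomReasoning {A B : Obj} = SetoidReasoning (hom-setoid A B)
  open HomReasoning

  ≈-refl : ∀ {A B} {f : A ⇒ B} → f ≈ f
  ≈-refl = IsEquivalence.refl ≈-equiv

  ≈-trans : ∀ {A B} {f g h : A ⇒ B} → f ≈ g → g ≈ h → f ≈ h
  ≈-trans = IsEquivalence.trans ≈-equiv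

  ∘-resp-≈ˡ : ∀ {A B C} {f h : B ⇒ C} {g : A ⇒ B} → f ≈ h → f ∘ g ≈ h ∘ g
  ∘-resp-≈ˡ p = ∘-resp-≈ p ≈-refl

  ∘-resp-≈ʳ : ∀ {A B C} {f : B ⇒ C} {g i : A ⇒ B} → g ≈ i → f ∘ g ≈ f ∘ i
  ∘-resp-≈ʳ p = ∘-resp-≈ ≈-refl p

  glueTriangles : ∀ {A B C D} {f : A ⇒ B} {g : B ⇒ C} {h : C ⇒ D} {gf : A ⇒ C} {hgf : A ⇒ D} →
                  g ∘ f ≈ gf → h ∘ gf ≈ hgf → (h ∘ g) ∘ f ≈ hgf
  glueTriangles p q = ≈-trans assoc (≈-trans (∘-resp-≈ʳ p) q)

  cancelʳ : ∀ {A B C} {f : A ⇒ C} {g : B ⇒ A} {h : A ⇒ B} → g ∘ h ≈ id → (f ∘ g) ∘ h ≈ f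
  cancelʳ p = glueTriangles p identityʳ

  cancelˡ : ∀ {A B C} {f : A ⇒ B} {g : C ⇒ B} {h : B ⇒ C} → g ∘ h ≈ id → g ∘ (h ∘ f) ≈ f
  cancelˡ p = ≈-trans (≈-sym assoc) (≈-trans (∘-resp-≈ˡ p) identityˡ)

  id-Iso : ∀ {A} → Iso (id {A})
  id-Iso = id , identityˡ , identityˡ

  inverse-Iso : ∀ {A B} {f : A ⇒ B} (i : Iso f) → Iso (proj₁ i)
  inverse-Iso {f = f} (_ , f⁻¹f , ff⁻¹) = f , ff⁻¹ , f⁻¹f

  iso-mono : ∀ {A B} {f : A ⇒ B} → Iso f → Mono f
  iso-mono i = M-mono (M-iso i)

  iso-epi : ∀ {A B} {f : A ⇒ B} → Iso f → Epi f
  iso-epi {f = f} (f⁻¹ , _ , ff⁻¹) g h gf≈hf = begin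
    g               ≈⟨ cancelʳ ff⁻¹ ⟨
    (g ∘ f) ∘ f⁻¹   ≈⟨ ∘-resp-≈ˡ gf≈hf ⟩
    (h ∘ f) ∘ f⁻¹   ≈⟨ cancelʳ ff⁻¹ ⟩
    h               ∎

  ∅-endo-id : (f : ∅ ⇒ ∅) → f ≈ id
  ∅-endo-id f = ≈-trans (¡-unique f (iso-mono (∅-strict f))) (≈-sym (¡-unique id (iso-mono id-Iso)))

  to-∅-unique : ∀ {Z} (g h : Z ⇒ ∅) → g ≈ h
  to-∅-unique g h with ∅-strict g
  ... | g⁻¹ , g⁻¹g , _ = begin
    g               ≈⟨ identityˡ ⟨
    id ∘ g          ≈⟨ ∘-resp-≈ˡ (∅-endo-id (h ∘ g⁻¹)) ⟨
    (h ∘ g⁻¹) ∘ g   ≈⟨ cancelʳ g⁻¹g ⟩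
    h               ∎

  ∅-initial : ∀ {B} (f : ∅ ⇒ B) → f ≈ ¡
  ∅-initial f = ¡-unique f (λ g h _ → to-∅-unique g h)

  ∅-covered-unique : ∀ {Z B} → Z ⇒ ∅ → (f g : Z ⇒ B) → f ≈ g
  ∅-covered-unique k f g with ∅-strict k
  ... | k⁻¹ , k⁻¹k , _ = begin
    f               ≈⟨ cancelʳ k⁻¹k ⟨
    (f ∘ k⁻¹) ∘ k   ≈⟨ ∘-resp-≈ˡ (≈-trans (∅-initial (f ∘ k⁻¹)) (≈-sym (∅-initial (g ∘ k⁻¹)))) ⟩
    (g ∘ k⁻¹) ∘ k   ≈⟨ cancelʳ k⁻¹k ⟩
    g               ∎

  ⊨-resp-≈ : ∀ {P G} (c : Cond P) {f g : P ⇒ G} → f ≈ g → f ⊨ c → g ⊨ c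
  ⊨-resp-≈ true       f≈g sat                  = sat
  ⊨-resp-≈ (∃c a _ c) f≈g (q , qM , qa≈f , sat) = q , qM , ≈-trans qa≈f f≈g , sat
  ⊨-resp-≈ (¬c c)     f≈g unsat sat            = unsat (⊨-resp-≈ c (≈-sym f≈g) sat)
  ⊨-resp-≈ (⋀ I cs)   f≈g sat i                = ⊨-resp-≈ (cs i) f≈g (sat i)

  -- u ⊨ ⋁ I cs unfolds to ¬ (∀ i → ¬ u ⊨ cs i).
  ¬∀¬-map : ∀ {I J : Set κ} {F : I → Set κ} {G : J → Set κ} (φ : I → J) →
            (∀ i → F i → G (φ i)) → ¬ (∀ i → ¬ F i) → ¬ (∀ j → ¬ G j)
  ¬∀¬-map φ convert sat none = sat (λ i fᵢ → none (φ i) (convert i fᵢ))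

  pushout-endo-id : ∀ {A B C D} {t : A ⇒ B} {l : A ⇒ C} {r : B ⇒ D} {b : C ⇒ D} →
                    IsPushout t l r b → (u : D ⇒ D) → u ∘ r ≈ r → u ∘ b ≈ b → u ≈ id
  pushout-endo-id po u ur≈r ub≈b =
    ≈-trans (unique commute u ur≈r ub≈b) (≈-sym (unique commute id identityˡ identityˡ))
    where open IsPushout po

  pushout-up-to-iso : ∀ {A B C D D'} {t : A ⇒ B} {l : A ⇒ C}
                      {r : B ⇒ D} {b : C ⇒ D} {r' : B ⇒ D'} {b' : C ⇒ D'} →
                      IsPushout t l r b → IsPushout t l r' b' →
                      Σ (D' ⇒ D) λ j → Iso j × (j ∘ r' ≈ r) × (j ∘ b' ≈ b)
  pushout-up-to-iso po po' = j , (j' , j'j≈id , jj'≈id) , jr'≈r , jb'≈b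
    where
    module P  = IsPushout po
    module P' = IsPushout po'
    j   = P'.universal P.commute
    j'  = P.universal P'.commute
    jr'≈r  = P'.factor₁ P.commute
    jb'≈b  = P'.factor₂ P.commute
    j'r≈r' = P.factor₁ P'.commute
    j'b≈b' = P.factor₂ P'.commute
    jj'≈id = pushout-endo-id po  (j ∘ j') (glueTriangles j'r≈r' jr'≈r) (glueTriangles j'b≈b' jb'≈b)
    j'j≈id = pushout-endo-id po' (j' ∘ j) (glueTriangles jr'≈r j'r≈r') (glueTriangles jb'≈b j'b≈b')

  pushout-precompose-iso : ∀ {Z A B C D} {t : A ⇒ B} {l : A ⇒ C} {r : B ⇒ D} {b : C ⇒ D}
                           {φ : Z ⇒ A} → Iso φ →
                           IsPushout t l r b → IsPushout (t ∘ φ) (l ∘ φ) r b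
  pushout-precompose-iso {t = t} {l} {φ = φ} φi po = record
    { commute   = ≈-trans (≈-sym assoc) (≈-trans (∘-resp-≈ˡ commute) assoc)
    ; universal = λ eq → universal (cancel-φ eq)
    ; factor₁   = λ eq → factor₁ (cancel-φ eq)
    ; factor₂   = λ eq → factor₂ (cancel-φ eq)
    ; unique    = λ eq → unique (cancel-φ eq)
    }
    where
    open IsPushout po
    cancel-φ : ∀ {X} {h : _ ⇒ X} {k : _ ⇒ X} → h ∘ (t ∘ φ) ≈ k ∘ (l ∘ φ) → h ∘ t ≈ k ∘ l
    cancel-φ eq = iso-epi φi _ _ (≈-trans assoc (≈-trans eq (≈-sym assoc)))

  pushout-reindex-left : ∀ {A B C C' D} {t : A ⇒ B} {l : A ⇒ C} {r : B ⇒ D} {b : C ⇒ D}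
                         {ψ : C ⇒ C'} {ψ⁻¹ : C' ⇒ C} → ψ⁻¹ ∘ ψ ≈ id → ψ ∘ ψ⁻¹ ≈ id →
                         IsPushout t l r b → IsPushout t (ψ ∘ l) r (b ∘ ψ⁻¹)
  pushout-reindex-left {l = l} {r} {b} {ψ} {ψ⁻¹} ψ⁻¹ψ ψψ⁻¹ po = record
    { commute   = ≈-trans commute (≈-sym (glueTriangles (cancelˡ ψ⁻¹ψ) ≈-refl))
    ; universal = λ eq → universal (≈-trans eq (≈-sym assoc))
    ; factor₁   = λ eq → factor₁ (≈-trans eq (≈-sym assoc))
    ; factor₂   = λ eq → ≈-trans (≈-sym assoc)
                           (≈-trans (∘-resp-≈ˡ (factor₂ (≈-trans eq (≈-sym assoc)))) (cancelʳ ψψ⁻¹))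
    ; unique    = λ eq u ur≈h ubψ⁻¹≈k →
                    unique (≈-trans eq (≈-sym assoc)) u ur≈h (move-ψ⁻¹ u ubψ⁻¹≈k)
    }
    where
    open IsPushout po
    move-ψ⁻¹ : ∀ {X} {k : _ ⇒ X} (u : _ ⇒ X) → u ∘ (b ∘ ψ⁻¹) ≈ k → u ∘ b ≈ k ∘ ψ
    move-ψ⁻¹ {k = k} u ubψ⁻¹≈k = begin
      u ∘ b               ≈⟨ cancelʳ ψ⁻¹ψ ⟨
      ((u ∘ b) ∘ ψ⁻¹) ∘ ψ ≈⟨ ∘-resp-≈ˡ (≈-trans assoc ubψ⁻¹≈k) ⟩
      k ∘ ψ               ∎

  pullback-transpose : ∀ {A B C D} {top : A ⇒ B} {left : A ⇒ C} {right : B ⇒ D} {bottom : C ⇒ D} →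
                       IsPullback top left right bottom → IsPullback left top bottom right
  pullback-transpose pb = record
    { commute   = ≈-sym commute
    ; universal = λ eq → universal (≈-sym eq)
    ; factor₁   = λ eq → factor₂ (≈-sym eq)
    ; factor₂   = λ eq → factor₁ (≈-sym eq)
    ; unique    = λ eq u p q → unique (≈-sym eq) u q p
    }
    where open IsPullback pb

  initial-pullback : ∀ {B' B} (c : B' ⇒ B) → IsPullback (¡ {B'}) id c (¡ {B})
  initial-pullback c = record
    { commute   = ≈-trans (∅-initial (c ∘ ¡)) (≈-sym identityʳ)
    ; universal = λ {_} {_} {k} _ → k
    ; factor₁   = λ {_} {h} {k} _ → ∅-covered-unique k (¡ ∘ k) h
    ; factor₂   = λ _ → identityˡ
    ; unique    = λ _ u _ idu≈k → ≈-trans (≈-sym identityˡ) idu≈k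
    }

  mono-pullback : ∀ {P X Y} {x : P ⇒ X} {μ : X ⇒ Y} {f : P ⇒ Y} →
                  Mono μ → μ ∘ x ≈ f → IsPullback x id μ f
  mono-pullback {x = x} {μ} {f} μ-mono μx≈f = record
    { commute   = ≈-trans μx≈f (≈-sym identityʳ)
    ; universal = λ {_} {_} {k} _ → k
    ; factor₁   = λ {_} {h} {k} eq →
                    μ-mono (x ∘ k) h (≈-trans (≈-sym assoc) (≈-trans (∘-resp-≈ˡ μx≈f) (≈-sym eq)))
    ; factor₂   = λ _ → identityˡ
    ; unique    = λ _ u _ idu≈k → ≈-trans (≈-sym identityˡ) idu≈k
    }

  ∃-pushout : ∀ {X Q A} (p'' : X ⇒ Q) (a'' : X ⇒ A) → M p'' → M a'' → Cond A → Cond Q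
  ∃-pushout p'' a'' p''M a''M c = ∃c r rM (Shift s sM c)
    where open SpanPushout p'' a'' p''M a''M

  ShiftSpan-transport : ∀ {P A E E'} {s : P ⇒ E} {s' : P ⇒ E'} {b : P ⇒ A} {j : E' ⇒ E} →
                        Iso j → j ∘ s' ≈ s → ShiftSpan s b → ShiftSpan s' b
  ShiftSpan-transport ji@(j⁻¹ , j⁻¹j , _) js'≈s σ = record
    { X = X ; p'' = j⁻¹ ∘ p'' ; a'' = a'' ; p''M = M-∘ p''M (M-iso (inverse-Iso ji))
    ; a''M = a''M ; x = x ; xM = xM
    ; p''x = glueTriangles p''x (≈-trans (∘-resp-≈ʳ (≈-sym js'≈s)) (cancelˡ j⁻¹j))
    ; a''x = a''x }
    where open ShiftSpan σ

  mutual
    Shift-transport : ∀ {A E E'} (c : Cond A) {s : A ⇒ E} {s' : A ⇒ E'} (sM : M s) (s'M : M s')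
                      {j : E' ⇒ E} → Iso j → j ∘ s' ≈ s →
                      ∀ {G} {u : E ⇒ G} → M u → u ⊨ Shift s sM c → (u ∘ j) ⊨ Shift s' s'M c
    Shift-transport true sM s'M ji js'≈s uM sat = sat
    Shift-transport (¬c c) sM s'M ji@(j⁻¹ , j⁻¹j , jj⁻¹) js'≈s uM unsat sat =
      unsat (⊨-resp-≈ (Shift _ sM c) (cancelʳ jj⁻¹)
        (Shift-transport c s'M sM (inverse-Iso ji)
          (≈-trans (∘-resp-≈ʳ (≈-sym js'≈s)) (cancelˡ j⁻¹j)) (M-∘ (M-iso ji) uM) sat))
    Shift-transport (⋀ I cs) sM s'M ji js'≈s uM sat i =
      Shift-transport (cs i) sM s'M ji js'≈s uM (sat i)
    Shift-transport (∃c b bM c) {s} sM s'M {j} ji@(j⁻¹ , j⁻¹j , jj⁻¹) js'≈s {u = u} uM =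
      ¬∀¬-map (ShiftSpan-transport ji js'≈s) reindexed
      where
      reindexed : (σ : ShiftSpan s b) → let open ShiftSpan σ in
                  u ⊨ ∃-pushout p'' a'' p''M a''M c →
                  (u ∘ j) ⊨ ∃-pushout (j⁻¹ ∘ p'') a'' (M-∘ p''M (M-iso (inverse-Iso ji))) a''M c
      reindexed σ =
        let _ , ki , ks'≈s , kr'≈rj = pushout-up-to-iso
                                        (pushout-reindex-left jj⁻¹ j⁻¹j (Pushout.isPushout S.po))
                                        (Pushout.isPushout S'.po)
        in ∃-Shift-transport c S.rM S'.rM S.sM S'.sM ki ks'≈s kr'≈rj
        where
        open ShiftSpan σ
        module S  = SpanPushout p'' a'' p''M a''M
        module S' = SpanPushout (j⁻¹ ∘ p'') a'' (M-∘ p''M (M-iso (inverse-Iso ji))) a''M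

    ∃-Shift-transport : ∀ {A Q Q' E E'} (c : Cond A) {r : Q ⇒ E} {r' : Q' ⇒ E'}
                        {s : A ⇒ E} {s' : A ⇒ E'} (rM : M r) (r'M : M r') (sM : M s) (s'M : M s')
                        {j : Q' ⇒ Q} {k : E' ⇒ E} → Iso k → k ∘ s' ≈ s → k ∘ r' ≈ r ∘ j →
                        ∀ {G} {u : Q ⇒ G} →
                        u ⊨ ∃c r rM (Shift s sM c) → (u ∘ j) ⊨ ∃c r' r'M (Shift s' s'M c)
    ∃-Shift-transport c rM r'M sM s'M ki ks'≈s kr'≈rj (v , vM , vr≈u , sat) =
      v ∘ _ , M-∘ (M-iso ki) vM ,
      glueTriangles kr'≈rj (≈-trans (≈-sym assoc) (∘-resp-≈ˡ vr≈u)) ,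
      Shift-transport c sM s'M ki ks'≈s vM sat

  ∃-pushout-precompose-iso : ∀ {X Y Q A} {p'' : X ⇒ Q} {a'' : X ⇒ A} (p''M : M p'') (a''M : M a'')
                             {φ : Y ⇒ X} (φi : Iso φ) (c : Cond A) {G} {u : Q ⇒ G} →
                             u ⊨ ∃-pushout p'' a'' p''M a''M c →
                             u ⊨ ∃-pushout (p'' ∘ φ) (a'' ∘ φ) (M-∘ (M-iso φi) p''M) (M-∘ (M-iso φi) a''M) c
  ∃-pushout-precompose-iso {p'' = p''} {a''} p''M a''M {φ} φi c sat =
    let _ , ki , ks'≈s , kr'≈r = pushout-up-to-iso (pushout-precompose-iso φi (Pushout.isPushout S.po))
                                                   (Pushout.isPushout S'.po)
    in ⊨-resp-≈ (∃c S'.r S'.rM (Shift S'.s S'.sM c)) identityʳ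
         (∃-Shift-transport c S.rM S'.rM S.sM S'.sM ki ks'≈s (≈-trans kr'≈r (≈-sym identityʳ)) sat)
    where
    module S  = SpanPushout p'' a'' p''M a''M
    module S' = SpanPushout (p'' ∘ φ) (a'' ∘ φ) (M-∘ (M-iso φi) p''M) (M-∘ (M-iso φi) a''M)

  module CoproductDecomposition {P Q X : Obj} {μ : X ⇒ P + Q} (μM : M μ)
                                {x : P ⇒ X} (μx≈inP : μ ∘ x ≈ inP P Q) where
    private
      pb : Pullback μ (inQ P Q)
      pb = pullback μ (inQ P Q) μM

    W : Obj
    W = Pullback.obj pb

    w : W ⇒ X
    w = Pullback.top pb

    w₁ : W ⇒ Q
    w₁ = Pullback.left pb

    isPullback : IsPullback w w₁ μ (inQ P Q)
    isPullback = Pullback.isPullback pb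

    w₁M : M w₁
    w₁M = pullback-stable μM isPullback

    wM : M w
    wM = pullback-stable (inQ-M P Q) (pullback-transpose isPullback)

    isCoproduct : IsPushout (¡ {P}) (¡ {W}) x w
    isCoproduct = proj₂ (van-Kampen ¡-M (Pushout.isPushout (coprod P Q))
                    (≈-trans (∅-initial (x ∘ ¡)) (≈-sym (∅-initial (w ∘ ¡))))
                    (≈-trans μx≈inP (≈-sym identityʳ)) (IsPullback.commute isPullback)
                    (initial-pullback id) (initial-pullback w₁)
                    (M-iso id-Iso) w₁M μM)
                  (mono-pullback (M-mono μM) μx≈inP , isPullback)

    private
      comparison : Σ (P + W ⇒ X) λ j → Iso j × (j ∘ inP P W ≈ x) × (j ∘ inQ P W ≈ w)
      comparison = pushout-up-to-iso isCoproduct (Pushout.isPushout (coprod P W))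

    copair : P + W ⇒ X
    copair = proj₁ comparison

    copair-Iso : Iso copair
    copair-Iso = proj₁ (proj₂ comparison)

    copair-inP : copair ∘ inP P W ≈ x
    copair-inP = proj₁ (proj₂ (proj₂ comparison))

    copair-inQ : copair ∘ inQ P W ≈ w
    copair-inQ = proj₂ (proj₂ (proj₂ comparison))

  module _ {P Q A : Obj} {a : P ⇒ A} (σ : ShiftSpan (inP P Q) a) where
    open ShiftSpan σ
    open CoproductDecomposition p''M p''x

    coprodSpan : CoprodSpan P Q a
    coprodSpan = record
      { W = W ; w₁ = w₁ ; w₂ = a'' ∘ w ; w₁M = w₁M ; w₂M = M-∘ wM a''M
      ; u₁ = p'' ∘ copair ; u₂ = a'' ∘ copair
      ; u₁-inP = glueTriangles copair-inP p''x
      ; u₁-inW = glueTriangles copair-inQ (IsPullback.commute isPullback)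
      ; u₂-inP = glueTriangles copair-inP a''x
      ; u₂-inW = glueTriangles copair-inQ ≈-refl
      ; u₁M = M-∘ (M-iso copair-Iso) p''M
      ; u₂M = M-∘ (M-iso copair-Iso) a''M
      }

    coprodSpan-disjunct : ∀ (c : Cond A) {G} {u : P + Q ⇒ G} →
                          u ⊨ ∃-pushout p'' a'' p''M a''M c →
                          let open CoprodSpan coprodSpan in u ⊨ ∃-pushout u₁ u₂ u₁M u₂M c
    coprodSpan-disjunct = ∃-pushout-precompose-iso p''M a''M copair-Iso

  shiftSpan : ∀ {P Q A : Obj} {a : P ⇒ A} → CoprodSpan P Q a → ShiftSpan (inP P Q) a
  shiftSpan {P} τ = record
    { X = P + W ; p'' = u₁ ; a'' = u₂ ; p''M = u₁M ; a''M = u₂M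
    ; x = inP P W ; xM = inP-M P W ; p''x = u₁-inP ; a''x = u₂-inP }
    where open CoprodSpan τ

lemma3p6 : ∀ {o ℓ e m : Level} (𝒞 : Category o ℓ e) (MA : MAdhesive 𝒞 m) →
           let open Category 𝒞
               open MAdhesive MA
               open Conditions 𝒞 MA
           in ∀ (P Q A : Obj) (a : P ⇒ A) (aM : M a) (c : Cond A) →
              Shift (inP P Q) (inP-M P Q) (∃c a aM c) ≡c RestrictedShift P Q a aM c
lemma3p6 𝒞 MA P Q A a aM c g gM =
  ¬∀¬-map coprodSpan (λ σ → coprodSpan-disjunct σ c) ,
  ¬∀¬-map shiftSpan (λ _ sat → sat)
  where open ShiftProperties 𝒞 MA
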